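{- Let $\mathfrak{H}=\mathbb{Q}\langle x,y\rangle$ with shuffle product $\sqcup\!\sqcup$, and $z_j=x^{j-1}y$. For all integers $k,n\geq 1$, \begin{align*} \sum_{r=0}^{k-2}(-1)^r\, z_2z_1^{k-r-2}\ \sqcup\!\sqcup\ z_{n+1}z_1^{r} &=\sum_{\substack{a_1+\dots+a_k=n\\ a_i\geq 0}}(a_k+1)\,z_{a_k+2}z_{a_1+1}z_{a_2+1}\cdots z_{a_{k-1}+1}\\ &\quad+(-1)^k\Big[\sum_{j=0}^{k-2} z_{n+1}z_1^{j}z_2z_1^{k-2-j}+(n+1)\,z_{n+2}z_1^{k-1}\Big]. \end{align*}
   Context: $\mathfrak{H}=\mathbb{Q}\langle x,y\rangle$ is the noncommutative polynomial algebra over $\mathbb{Q}$ in letters $x,y$; $z_j=x^{j-1}y$ for positive integers $j$, and $z_1^0=1$. The shuffle product $\sqcup\!\sqcup$ on $\mathfrak{H}$ is the $\mathbb{Q}$-bilinear product defined on words by $1\sqcup\!\sqcup w=w\sqcup\!\sqcup 1=w$ and $aw_1\sqcup\!\sqcup bw_2=a(w_1\sqcup\!\sqcup bw_2)+b(aw_1\sqcup\!\sqcup w_2)$ for letters $a,b\in\{x,y\}$ and words $w_1,w_2$. Empty sums are $0$; for $k=1$ the product $z_{a_1+1}\cdots z_{a_{k-1}+1}$ is $1$. -}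

module Defs where

open import Data.Nat as ℕ using (ℕ; zero; suc; _∸_)
open import Data.Integer using (+_)
open import Data.Rational using (ℚ; 0ℚ; 1ℚ; -_; _/_)
import Data.Rational as Q
open import Data.List using (List; []; _∷_; _++_; map; concatMap; replicate; reverse; filter; upTo; foldr)
import Data.List.Properties as LP
open import Data.Nat.ListAction using (sum)
open import Data.Product using (_×_; _,_)
open import Relation.Binary.PropositionalEquality using (_≡_)
open import Relation.Nullary using (yes; no)

data Letter : Set where
  x y : Letter

Word : Set
Word = List Letter

_≟L_ : (a b : Letter) → Relation.Nullary.Dec (a ≡ b)
x ≟L x = yes _≡_.refl
x ≟L y = no (λ ())
y ≟L x = no (λ ())
y ≟L y = yes _≡_.refl

_≟W_ : (u v : Word) → Relation.Nullary.Dec (u ≡ v)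
_≟W_ = LP.≡-dec _≟L_

-- Elements of ℌ: finite formal ℚ-linear combinations of words
Poly : Set
Poly = List (ℚ × Word)

coeff : Poly → Word → ℚ
coeff [] w = 0ℚ
coeff ((c , u) ∷ p) w with u ≟W w
... | yes _ = c Q.+ coeff p w
... | no _ = coeff p w

infix 4 _≈_
_≈_ : Poly → Poly → Set
p ≈ q = ∀ w → coeff p w ≡ coeff q w

𝟘 : Poly
𝟘 = []

word : Word → Poly
word w = (1ℚ , w) ∷ []

infixl 6 _⊕_
_⊕_ : Poly → Poly → Poly
p ⊕ q = p ++ q

infixl 7 _·_
_·_ : ℚ → Poly → Poly
c · p = map (λ { (d , u) → (c Q.* d , u) }) p

Σ : {A : Set} → List A → (A → Poly) → Poly
Σ xs f = foldr (λ a acc → f a ⊕ acc) 𝟘 xs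

ℕ→ℚ : ℕ → ℚ
ℕ→ℚ n = + n / 1

sgn : ℕ → ℚ
sgn zero = 1ℚ
sgn (suc r) = - sgn r

shW : Word → Word → List Word
shW [] v = v ∷ []
shW (a ∷ u) [] = (a ∷ u) ∷ []
shW (a ∷ u) (b ∷ v) = map (a ∷_) (shW u (b ∷ v)) ++ map (b ∷_) (shW (a ∷ u) v)

infixl 7 _⧢_
_⧢_ : Poly → Poly → Poly
p ⧢ q = concatMap (λ { (c , u) → concatMap (λ { (d , v) → map (λ w → (c Q.* d , w)) (shW u v) }) q }) p

z : ℕ → Word
z j = replicate (j ∸ 1) x ++ (y ∷ [])

z1^ : ℕ → Word
z1^ r = concatMap (λ _ → z 1) (upTo r)

boxes : ℕ → ℕ → List (List ℕ)
boxes zero n = [] ∷ []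
boxes (suc k) n = concatMap (λ a → map (a ∷_) (boxes k n)) (upTo (suc n))

compositions : ℕ → ℕ → List (List ℕ)
compositions k n = filter (λ as → sum as ℕ.≟ n) (boxes k n)

compTerm : List ℕ → Poly
compTerm as with reverse as
... | [] = 𝟘
... | ak ∷ rest = ℕ→ℚ (suc ak) · word (z (ak ℕ.+ 2) ++ concatMap (λ a → z (suc a)) (reverse rest))

-- Pair both sides with an arbitrary test function g : Word → ℚ: polynomials with the same
-- pairings are equal, and the pairing of u ⧢ v is a sum of g over the interleavings of u and v.
-- Write k = m + 1 and H r = ⟨(x y^(m−r) ⧢ x^n y^r) y ∣ g⟩. Both words of the r-th summand end
-- in y, and splitting a shuffle according to which word supplies its last letter shows that the
-- summand pairs to H (r + 1) + H r; so the alternating sum telescopes to H 0 + (−1)^k H m.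
-- In H 0 the leading x lands after i letters of x^n, and y^m ⧢ x^(n−i) followed by y is the sum of
-- z_(b₁+1) ⋯ z_(b_k+1) over the compositions b of n − i; merging i and b₁ into a_k = i + b₁ gives
-- the weight a_k + 1, and moving that part to the end gives the composition sum. In H m the single
-- x is inserted into x^n y^m: the n + 1 slots in or right after the x-block give z_(n+2) z_1^(k−1),
-- and the slot after the (j+1)-th y gives z_(n+1) z_1^j z_2 z_1^(k−2−j).

module Submission where

open import Defs
open import Data.Nat using (ℕ; _≤_; _∸_; _+_; suc)
open import Data.List using (upTo; _++_)

open import Algebra.Bundles using (CommutativeMonoid)
open import Data.Bool using (true; false; if_then_else_)
open import Data.List using (List; []; _∷_; map; concatMap; replicate; reverse; filter; applyUpTo; _∷ʳ_)
import Data.List.Properties as LP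
open import Data.Nat as ℕ using (zero; _<_; _<ᵇ_; _≡ᵇ_; z≤n; s≤s)
import Data.Nat.Properties as ℕP
open import Data.Nat.ListAction using (sum)
import Data.Integer as ℤ
open import Data.Integer using (+_)
import Data.Integer.Properties as ℤP
import Data.Nat.Coprimality as Coprimality
open import Data.Product using (_,_)
open import Data.Rational as ℚ using (ℚ; 0ℚ; 1ℚ; -_; _*_)
import Data.Rational.Properties as ℚP
open import Data.Rational.Solver using (module +-*-Solver)
import Level
open import Function using (_∘_; flip)
open import Relation.Binary.PropositionalEquality
open import Relation.Nullary using (yes; no; does)
open import Relation.Unary using (Pred; Decidable)

open import Algebra.Properties.CommutativeSemigroup
  (CommutativeMonoid.commutativeSemigroup ℚP.+-0-commutativeMonoid)
  using (interchange; x∙yz≈y∙xz; xy∙z≈xz∙y)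
open +-*-Solver using (solve; _:+_; _:*_; :-_; _:=_; con)
open ≡-Reasoning

-- Once + n / 1 is normalised to mkℚ (+ n) 0 _, the sum 1ℚ + ℕ→ℚ n unfolds to a fraction over 1.
ℕ→ℚ-suc : ∀ n → ℕ→ℚ (suc n) ≡ 1ℚ ℚ.+ ℕ→ℚ n
ℕ→ℚ-suc n =
  trans (ℚP./-cong {+ suc n} {1} {_} {1} numerator refl)
        (cong (1ℚ ℚ.+_) (sym (ℚP.normalize-coprime (Coprimality.sym (Coprimality.1-coprimeTo n)))))
  where
  numerator : + suc n ≡ (+ 1 ℤ.* + 1) ℤ.+ (+ n ℤ.* + 1)
  numerator = cong (λ t → + 1 ℤ.+ t) (sym (ℤP.*-identityʳ (+ n)))

ℕ→ℚ-+1 : ∀ n → ℕ→ℚ (n + 1) ≡ 1ℚ ℚ.+ ℕ→ℚ n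
ℕ→ℚ-+1 n = trans (cong ℕ→ℚ (ℕP.+-comm n 1)) (ℕ→ℚ-suc n)

sumList : {A : Set} → List A → (A → ℚ) → ℚ
sumList [] f = 0ℚ
sumList (a ∷ as) f = f a ℚ.+ sumList as f

sumList-cong : {A : Set} (as : List A) {f g : A → ℚ} → (∀ a → f a ≡ g a) →
  sumList as f ≡ sumList as g
sumList-cong [] f≗g = refl
sumList-cong (a ∷ as) f≗g = cong₂ ℚ._+_ (f≗g a) (sumList-cong as f≗g)

sumList-zero : {A : Set} (as : List A) → sumList as (λ _ → 0ℚ) ≡ 0ℚ
sumList-zero [] = refl
sumList-zero (a ∷ as) = trans (ℚP.+-identityˡ _) (sumList-zero as)

sumList-++ : {A : Set} (as bs : List A) (f : A → ℚ) →
  sumList (as ++ bs) f ≡ sumList as f ℚ.+ sumList bs f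
sumList-++ [] bs f = sym (ℚP.+-identityˡ _)
sumList-++ (a ∷ as) bs f = trans (cong (f a ℚ.+_) (sumList-++ as bs f)) (sym (ℚP.+-assoc (f a) _ _))

sumList-map : {A B : Set} (h : A → B) (as : List A) (f : B → ℚ) →
  sumList (map h as) f ≡ sumList as (f ∘ h)
sumList-map h [] f = refl
sumList-map h (a ∷ as) f = cong (f (h a) ℚ.+_) (sumList-map h as f)

sumList-concatMap : {A B : Set} (h : A → List B) (as : List A) (f : B → ℚ) →
  sumList (concatMap h as) f ≡ sumList as (λ a → sumList (h a) f)
sumList-concatMap h [] f = refl
sumList-concatMap h (a ∷ as) f =
  trans (sumList-++ (h a) (concatMap h as) f) (cong (sumList (h a) f ℚ.+_) (sumList-concatMap h as f))

sumList-filter : {A : Set} {P : Pred A Level.zero} (P? : Decidable P) (as : List A) (f : A → ℚ) →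
  sumList (filter P? as) f ≡ sumList as (λ a → if does (P? a) then f a else 0ℚ)
sumList-filter P? [] f = refl
sumList-filter P? (a ∷ as) f with does (P? a)
... | true = cong (f a ℚ.+_) (sumList-filter P? as f)
... | false = trans (sumList-filter P? as f) (sym (ℚP.+-identityˡ _))

sumRange : ℕ → (ℕ → ℚ) → ℚ
sumRange zero f = 0ℚ
sumRange (suc n) f = f 0 ℚ.+ sumRange n (f ∘ suc)

sumList-applyUpTo : (h : ℕ → ℕ) (n : ℕ) (f : ℕ → ℚ) →
  sumList (applyUpTo h n) f ≡ sumRange n (f ∘ h)
sumList-applyUpTo h zero f = refl
sumList-applyUpTo h (suc n) f = cong (f (h 0) ℚ.+_) (sumList-applyUpTo (h ∘ suc) n f)

sumList-upTo : (n : ℕ) (f : ℕ → ℚ) → sumList (upTo n) f ≡ sumRange n f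
sumList-upTo = sumList-applyUpTo (λ i → i)

sumRange-cong< : (n : ℕ) {f g : ℕ → ℚ} → (∀ i → i < n → f i ≡ g i) →
  sumRange n f ≡ sumRange n g
sumRange-cong< zero f≗g = refl
sumRange-cong< (suc n) f≗g =
  cong₂ ℚ._+_ (f≗g 0 (s≤s z≤n)) (sumRange-cong< n (λ i i<n → f≗g (suc i) (s≤s i<n)))

sumRange-cong : (n : ℕ) {f g : ℕ → ℚ} → (∀ i → f i ≡ g i) → sumRange n f ≡ sumRange n g
sumRange-cong n f≗g = sumRange-cong< n (λ i _ → f≗g i)

sumRange-zero : (n : ℕ) → sumRange n (λ _ → 0ℚ) ≡ 0ℚ
sumRange-zero zero = refl
sumRange-zero (suc n) = trans (ℚP.+-identityˡ _) (sumRange-zero n)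

sumRange-+ : (n : ℕ) (f g : ℕ → ℚ) →
  sumRange n (λ i → f i ℚ.+ g i) ≡ sumRange n f ℚ.+ sumRange n g
sumRange-+ zero f g = sym (ℚP.+-identityˡ 0ℚ)
sumRange-+ (suc n) f g =
  trans (cong (f 0 ℚ.+ g 0 ℚ.+_) (sumRange-+ n (f ∘ suc) (g ∘ suc))) (interchange (f 0) (g 0) _ _)

sumRange-*ˡ : (n : ℕ) (c : ℚ) (f : ℕ → ℚ) → sumRange n (λ i → c * f i) ≡ c * sumRange n f
sumRange-*ˡ zero c f = sym (ℚP.*-zeroʳ c)
sumRange-*ˡ (suc n) c f =
  trans (cong (c * f 0 ℚ.+_) (sumRange-*ˡ n c (f ∘ suc))) (sym (ℚP.*-distribˡ-+ c (f 0) _))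

sumRange-neg : (n : ℕ) (f : ℕ → ℚ) → sumRange n (λ i → - f i) ≡ - sumRange n f
sumRange-neg zero f = refl
sumRange-neg (suc n) f =
  trans (cong (- f 0 ℚ.+_) (sumRange-neg n (f ∘ suc))) (sym (ℚP.neg-distrib-+ (f 0) _))

sumRange-comm : (m n : ℕ) (f : ℕ → ℕ → ℚ) →
  sumRange m (λ i → sumRange n (f i)) ≡ sumRange n (λ j → sumRange m (λ i → f i j))
sumRange-comm zero n f = sym (sumRange-zero n)
sumRange-comm (suc m) n f =
  trans (cong (sumRange n (f 0) ℚ.+_) (sumRange-comm m n (f ∘ suc))) (sym (sumRange-+ n (f 0) _))

sumRange-alternating-telescope : (n : ℕ) (h : ℕ → ℚ) →
  sumRange n (λ r → sgn r * (h (suc r) ℚ.+ h r)) ≡ h 0 ℚ.+ sgn (suc n) * h n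
sumRange-alternating-telescope zero h = solve 1 (λ a → con 0ℚ := a :+ (:- con 1ℚ) :* a) refl (h 0)
sumRange-alternating-telescope (suc n) h = begin
    1ℚ * (h 1 ℚ.+ h 0) ℚ.+ sumRange n (λ r → - sgn r * (h (2 + r) ℚ.+ h (suc r)))
  ≡⟨ cong (1ℚ * (h 1 ℚ.+ h 0) ℚ.+_) shifted ⟩
    1ℚ * (h 1 ℚ.+ h 0) ℚ.+ - (h 1 ℚ.+ sgn (suc n) * h (suc n))
  ≡⟨ solve 4 (λ a b s c → con 1ℚ :* (a :+ b) :+ (:- (a :+ s :* c)) := b :+ (:- s) :* c)
       refl (h 1) (h 0) (sgn (suc n)) (h (suc n)) ⟩
    h 0 ℚ.+ sgn (2 + n) * h (suc n)
  ∎
  where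
  shifted : sumRange n (λ r → - sgn r * (h (2 + r) ℚ.+ h (suc r)))
          ≡ - (h 1 ℚ.+ sgn (suc n) * h (suc n))
  shifted = trans (sumRange-cong n (λ r → sym (ℚP.neg-distribˡ-* (sgn r) _)))
                  (trans (sumRange-neg n _) (cong -_ (sumRange-alternating-telescope n (h ∘ suc))))

sumRange-extend : (s N : ℕ) (f : ℕ → ℚ) → s ≤ N →
  sumRange s f ≡ sumRange N (λ i → if i <ᵇ s then f i else 0ℚ)
sumRange-extend zero N f _ = sym (sumRange-zero N)
sumRange-extend (suc s) (suc N) f (s≤s s≤N) = cong (f 0 ℚ.+_) (sumRange-extend s N (f ∘ suc) s≤N)

≤⇒<ᵇ-suc : ∀ {a s} → a ≤ s → (a <ᵇ suc s) ≡ true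
≤⇒<ᵇ-suc z≤n = refl
≤⇒<ᵇ-suc (s≤s a≤s) = ≤⇒<ᵇ-suc a≤s

>⇒<ᵇ-suc : ∀ {a s} → s < a → (a <ᵇ suc s) ≡ false
>⇒<ᵇ-suc {suc a} {zero} _ = refl
>⇒<ᵇ-suc {suc a} {suc s} (s≤s s<a) = >⇒<ᵇ-suc s<a

<ᵇ-suc-∸ : ∀ a n c → a ≤ n → (c <ᵇ suc (n ∸ a)) ≡ (a + c <ᵇ suc n)
<ᵇ-suc-∸ zero n c _ = refl
<ᵇ-suc-∸ (suc a) (suc n) c (s≤s a≤n) = <ᵇ-suc-∸ a n c a≤n

sumTriangle : ℕ → (ℕ → ℕ → ℚ) → ℚ
sumTriangle n f = sumRange (suc n) (λ a → sumRange (suc (n ∸ a)) (f a))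

sumTriangle-square : (n : ℕ) (f : ℕ → ℕ → ℚ) →
  sumTriangle n f
  ≡ sumRange (suc n) (λ a → sumRange (suc n) (λ c → if a + c <ᵇ suc n then f a c else 0ℚ))
sumTriangle-square n f = sumRange-cong< (suc n) (λ a a≤n →
  trans (sumRange-extend (suc (n ∸ a)) (suc n) (f a) (s≤s (ℕP.m∸n≤m n a)))
        (sumRange-cong (suc n) (λ c →
           cong (λ b → if b then f a c else 0ℚ) (<ᵇ-suc-∸ a n c (ℕP.≤-pred a≤n)))))

sumTriangle-comm : (n : ℕ) (f : ℕ → ℕ → ℚ) → sumTriangle n f ≡ sumTriangle n (flip f)
sumTriangle-comm n f = begin
    sumTriangle n f
  ≡⟨ sumTriangle-square n f ⟩
    sumRange (suc n) (λ a → sumRange (suc n) (λ c → if a + c <ᵇ suc n then f a c else 0ℚ))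
  ≡⟨ sumRange-comm (suc n) (suc n) (λ a c → if a + c <ᵇ suc n then f a c else 0ℚ) ⟩
    sumRange (suc n) (λ c → sumRange (suc n) (λ a → if a + c <ᵇ suc n then f a c else 0ℚ))
  ≡⟨ sumRange-cong (suc n) (λ c → sumRange-cong (suc n) (λ a →
       cong (λ t → if t <ᵇ suc n then f a c else 0ℚ) (ℕP.+-comm a c))) ⟩
    sumRange (suc n) (λ c → sumRange (suc n) (λ a → if c + a <ᵇ suc n then f a c else 0ℚ))
  ≡⟨ sym (sumTriangle-square n (flip f)) ⟩
    sumTriangle n (flip f)
  ∎

sumTriangle-antidiagonal : (n : ℕ) (f : ℕ → ℕ → ℚ) →
  sumTriangle n (λ a b → f (a + b) (n ∸ a ∸ b)) ≡ sumRange (suc n) (λ c → ℕ→ℚ (suc c) * f c (n ∸ c))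
sumTriangle-antidiagonal zero f =
  solve 1 (λ a → (a :+ con 0ℚ) :+ con 0ℚ := con 1ℚ :* a :+ con 0ℚ) refl (f 0 0)
sumTriangle-antidiagonal (suc n) f = begin
    (f 0 (suc n) ℚ.+ S) ℚ.+ sumTriangle n (λ a b → f (suc (a + b)) (n ∸ a ∸ b))
  ≡⟨ cong ((f 0 (suc n) ℚ.+ S) ℚ.+_) (sumTriangle-antidiagonal n (f ∘ suc)) ⟩
    (f 0 (suc n) ℚ.+ S) ℚ.+ S′
  ≡⟨ solve 3 (λ a b c → (a :+ b) :+ c := con 1ℚ :* a :+ (b :+ c)) refl (f 0 (suc n)) S S′ ⟩
    1ℚ * f 0 (suc n) ℚ.+ (S ℚ.+ S′)
  ≡⟨ cong (1ℚ * f 0 (suc n) ℚ.+_) (sym (sumRange-+ (suc n) (λ c → f (suc c) (n ∸ c))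
                                                          (λ c → ℕ→ℚ (suc c) * f (suc c) (n ∸ c)))) ⟩
    1ℚ * f 0 (suc n) ℚ.+ sumRange (suc n) (λ c → f (suc c) (n ∸ c) ℚ.+ ℕ→ℚ (suc c) * f (suc c) (n ∸ c))
  ≡⟨ cong (1ℚ * f 0 (suc n) ℚ.+_)
          (sumRange-cong (suc n) (λ c → sym (suc-* (suc c) (f (suc c) (n ∸ c))))) ⟩
    1ℚ * f 0 (suc n) ℚ.+ sumRange (suc n) (λ c → ℕ→ℚ (2 + c) * f (suc c) (n ∸ c))
  ∎
  where
  S S′ : ℚ
  S = sumRange (suc n) (λ c → f (suc c) (n ∸ c))
  S′ = sumRange (suc n) (λ c → ℕ→ℚ (suc c) * f (suc c) (n ∸ c))
  suc-* : ∀ k q → ℕ→ℚ (suc k) * q ≡ q ℚ.+ ℕ→ℚ k * q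
  suc-* k q = trans (cong (_* q) (ℕ→ℚ-suc k))
                    (solve 2 (λ c q → (con 1ℚ :+ c) :* q := q :+ c :* q) refl (ℕ→ℚ k) q)

⟨_∣_⟩ : Poly → (Word → ℚ) → ℚ
⟨ p ∣ g ⟩ = sumList p (λ { (c , u) → c * g u })

⟨⊕⟩ : (p q : Poly) (g : Word → ℚ) → ⟨ p ⊕ q ∣ g ⟩ ≡ ⟨ p ∣ g ⟩ ℚ.+ ⟨ q ∣ g ⟩
⟨⊕⟩ p q g = sumList-++ p q _

⟨·⟩ : (c : ℚ) (p : Poly) (g : Word → ℚ) → ⟨ c · p ∣ g ⟩ ≡ c * ⟨ p ∣ g ⟩
⟨·⟩ c [] g = sym (ℚP.*-zeroʳ c)
⟨·⟩ c ((d , u) ∷ p) g =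
  trans (cong₂ ℚ._+_ (ℚP.*-assoc c d (g u)) (⟨·⟩ c p g)) (sym (ℚP.*-distribˡ-+ c _ _))

⟨Σ⟩ : {A : Set} (as : List A) (f : A → Poly) (g : Word → ℚ) →
  ⟨ Σ as f ∣ g ⟩ ≡ sumList as (λ a → ⟨ f a ∣ g ⟩)
⟨Σ⟩ [] f g = refl
⟨Σ⟩ (a ∷ as) f g = trans (⟨⊕⟩ (f a) (Σ as f) g) (cong (⟨ f a ∣ g ⟩ ℚ.+_) (⟨Σ⟩ as f g))

⟨word⟩ : (u : Word) (g : Word → ℚ) → ⟨ word u ∣ g ⟩ ≡ g u
⟨word⟩ u g = trans (ℚP.+-identityʳ _) (ℚP.*-identityˡ (g u))

coeff≡⟨⟩ : (p : Poly) (w : Word) → coeff p w ≡ ⟨ p ∣ (λ u → coeff (word u) w) ⟩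
coeff≡⟨⟩ [] w = refl
coeff≡⟨⟩ ((c , u) ∷ p) w with u ≟W w
... | yes _ = cong₂ ℚ._+_ (sym (trans (cong (c *_) (ℚP.+-identityʳ 1ℚ)) (ℚP.*-identityʳ c))) (coeff≡⟨⟩ p w)
... | no _ = trans (coeff≡⟨⟩ p w)
                   (sym (trans (cong (ℚ._+ ⟨ p ∣ (λ v → coeff (word v) w) ⟩) (ℚP.*-zeroʳ c)) (ℚP.+-identityˡ _)))

≈-from-⟨⟩ : {p q : Poly} → (∀ g → ⟨ p ∣ g ⟩ ≡ ⟨ q ∣ g ⟩) → p ≈ q
≈-from-⟨⟩ {p} {q} p≡q w = trans (coeff≡⟨⟩ p w) (trans (p≡q _) (sym (coeff≡⟨⟩ q w)))

shuffleSum : Word → Word → (Word → ℚ) → ℚ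
shuffleSum [] v g = g v
shuffleSum (a ∷ u) [] g = g (a ∷ u)
shuffleSum (a ∷ u) (b ∷ v) g =
  shuffleSum u (b ∷ v) (g ∘ (a ∷_)) ℚ.+ shuffleSum (a ∷ u) v (g ∘ (b ∷_))

shuffleSum-cong : (u v : Word) {g h : Word → ℚ} → (∀ t → g t ≡ h t) →
  shuffleSum u v g ≡ shuffleSum u v h
shuffleSum-cong [] v g≗h = g≗h v
shuffleSum-cong (a ∷ u) [] g≗h = g≗h (a ∷ u)
shuffleSum-cong (a ∷ u) (b ∷ v) g≗h =
  cong₂ ℚ._+_ (shuffleSum-cong u (b ∷ v) (g≗h ∘ (a ∷_))) (shuffleSum-cong (a ∷ u) v (g≗h ∘ (b ∷_)))

sumList-shW : (u v : Word) (g : Word → ℚ) → sumList (shW u v) g ≡ shuffleSum u v g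
sumList-shW [] v g = ℚP.+-identityʳ (g v)
sumList-shW (a ∷ u) [] g = ℚP.+-identityʳ (g (a ∷ u))
sumList-shW (a ∷ u) (b ∷ v) g =
  trans (sumList-++ (map (a ∷_) (shW u (b ∷ v))) _ g)
        (cong₂ ℚ._+_
          (trans (sumList-map (a ∷_) (shW u (b ∷ v)) g) (sumList-shW u (b ∷ v) (g ∘ (a ∷_))))
          (trans (sumList-map (b ∷_) (shW (a ∷ u) v) g) (sumList-shW (a ∷ u) v (g ∘ (b ∷_)))))

⟨⧢⟩ : (u v : Word) (g : Word → ℚ) → ⟨ word u ⧢ word v ∣ g ⟩ ≡ shuffleSum u v g
⟨⧢⟩ u v g = begin
    ⟨ word u ⧢ word v ∣ g ⟩
  ≡⟨ cong (λ p → ⟨ p ∣ g ⟩)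
          (trans (LP.++-identityʳ _) (LP.++-identityʳ (map (λ t → (1ℚ * 1ℚ , t)) (shW u v)))) ⟩
    ⟨ map (λ t → (1ℚ * 1ℚ , t)) (shW u v) ∣ g ⟩
  ≡⟨ sumList-map _ (shW u v) _ ⟩
    sumList (shW u v) (λ t → 1ℚ * g t)
  ≡⟨ sumList-cong (shW u v) (λ t → ℚP.*-identityˡ (g t)) ⟩
    sumList (shW u v) g
  ≡⟨ sumList-shW u v g ⟩
    shuffleSum u v g
  ∎

shuffleSum-[]ʳ : (u : Word) (g : Word → ℚ) → shuffleSum u [] g ≡ g u
shuffleSum-[]ʳ [] g = refl
shuffleSum-[]ʳ (a ∷ u) g = refl

shuffleSum-∷ʳ : (u v : Word) (a b : Letter) (g : Word → ℚ) →
  shuffleSum (u ∷ʳ a) (v ∷ʳ b) g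
  ≡ shuffleSum u (v ∷ʳ b) (g ∘ (_∷ʳ a)) ℚ.+ shuffleSum (u ∷ʳ a) v (g ∘ (_∷ʳ b))
shuffleSum-∷ʳ [] [] a b g = ℚP.+-comm (g (a ∷ b ∷ [])) (g (b ∷ a ∷ []))
shuffleSum-∷ʳ [] (d ∷ v) a b g =
  trans (cong (g (a ∷ d ∷ v ∷ʳ b) ℚ.+_) (shuffleSum-∷ʳ [] v a b (g ∘ (d ∷_))))
        (x∙yz≈y∙xz (g (a ∷ d ∷ v ∷ʳ b)) (g (d ∷ (v ∷ʳ b) ∷ʳ a))
                   (shuffleSum (a ∷ []) v (λ t → g (d ∷ t ∷ʳ b))))
shuffleSum-∷ʳ (c ∷ u) [] a b g =
  trans (cong (ℚ._+ g (b ∷ c ∷ u ∷ʳ a))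
              (trans (shuffleSum-∷ʳ u [] a b (g ∘ (c ∷_)))
                     (cong (X ℚ.+_) (shuffleSum-[]ʳ (u ∷ʳ a) (λ t → g (c ∷ t ∷ʳ b))))))
        (xy∙z≈xz∙y X (g (c ∷ (u ∷ʳ a) ∷ʳ b)) (g (b ∷ c ∷ u ∷ʳ a)))
  where
  X : ℚ
  X = shuffleSum u (b ∷ []) (λ t → g (c ∷ t ∷ʳ a))
shuffleSum-∷ʳ (c ∷ u) (d ∷ v) a b g =
  trans (cong₂ ℚ._+_ (shuffleSum-∷ʳ u (d ∷ v) a b (g ∘ (c ∷_)))
                     (shuffleSum-∷ʳ (c ∷ u) v a b (g ∘ (d ∷_))))
        (interchange (shuffleSum u ((d ∷ v) ∷ʳ b) (λ t → g (c ∷ t ∷ʳ a)))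
                     (shuffleSum (u ∷ʳ a) (d ∷ v) (λ t → g (c ∷ t ∷ʳ b)))
                     (shuffleSum (c ∷ u) (v ∷ʳ b) (λ t → g (d ∷ t ∷ʳ a)))
                     (shuffleSum ((c ∷ u) ∷ʳ a) v (λ t → g (d ∷ t ∷ʳ b))))

sumCompositions : ℕ → ℕ → (List ℕ → ℚ) → ℚ
sumCompositions zero zero f = f []
sumCompositions zero (suc _) f = 0ℚ
sumCompositions (suc k) n f = sumRange (suc n) (λ a → sumCompositions k (n ∸ a) (f ∘ (a ∷_)))

sumCompositions-cong : (k n : ℕ) {f g : List ℕ → ℚ} → (∀ as → f as ≡ g as) →
  sumCompositions k n f ≡ sumCompositions k n g
sumCompositions-cong zero zero f≗g = f≗g []
sumCompositions-cong zero (suc n) f≗g = refl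
sumCompositions-cong (suc k) n f≗g =
  sumRange-cong (suc n) (λ a → sumCompositions-cong k (n ∸ a) (f≗g ∘ (a ∷_)))

sumCompositions₀-cong : (n : ℕ) {f g : List ℕ → ℚ} → f [] ≡ g [] →
  sumCompositions zero n f ≡ sumCompositions zero n g
sumCompositions₀-cong zero f[]≡g[] = f[]≡g[]
sumCompositions₀-cong (suc n) _ = refl

sumCompositions-*ˡ : (k n : ℕ) (c : ℚ) (f : List ℕ → ℚ) →
  sumCompositions k n (λ as → c * f as) ≡ c * sumCompositions k n f
sumCompositions-*ˡ zero zero c f = refl
sumCompositions-*ˡ zero (suc n) c f = sym (ℚP.*-zeroʳ c)
sumCompositions-*ˡ (suc k) n c f =
  trans (sumRange-cong (suc n) (λ a → sumCompositions-*ˡ k (n ∸ a) c (f ∘ (a ∷_))))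
        (sumRange-*ˡ (suc n) c (λ a → sumCompositions k (n ∸ a) (f ∘ (a ∷_))))

sumCompositions-singleton : (n : ℕ) (f : ℕ → List ℕ → ℚ) →
  sumRange (suc n) (λ a → sumCompositions zero (n ∸ a) (f a)) ≡ f n []
sumCompositions-singleton zero f = ℚP.+-identityʳ _
sumCompositions-singleton (suc n) f = trans (ℚP.+-identityˡ _) (sumCompositions-singleton n (f ∘ suc))

m∸n∸o≡m∸o∸n : ∀ m n o → m ∸ n ∸ o ≡ m ∸ o ∸ n
m∸n∸o≡m∸o∸n m n o =
  trans (ℕP.∸-+-assoc m n o) (trans (cong (m ∸_) (ℕP.+-comm n o)) (sym (ℕP.∸-+-assoc m o n)))

sumCompositions-∷ʳ : (k n : ℕ) (f : List ℕ → ℚ) →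
  sumCompositions (suc k) n f ≡ sumRange (suc n) (λ c → sumCompositions k (n ∸ c) (λ as → f (as ∷ʳ c)))
sumCompositions-∷ʳ zero n f =
  sumRange-cong (suc n) (λ a → sumCompositions₀-cong (n ∸ a) {f ∘ (a ∷_)} {λ as → f (as ∷ʳ a)} refl)
sumCompositions-∷ʳ (suc k) n f = begin
    sumRange (suc n) (λ a → sumCompositions (suc k) (n ∸ a) (f ∘ (a ∷_)))
  ≡⟨ sumRange-cong (suc n) (λ a → sumCompositions-∷ʳ k (n ∸ a) (f ∘ (a ∷_))) ⟩
    sumTriangle n (λ a c → sumCompositions k (n ∸ a ∸ c) (λ as → f (a ∷ as ∷ʳ c)))
  ≡⟨ sumTriangle-comm n (λ a c → sumCompositions k (n ∸ a ∸ c) (λ as → f (a ∷ as ∷ʳ c))) ⟩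
    sumTriangle n (λ c a → sumCompositions k (n ∸ a ∸ c) (λ as → f (a ∷ as ∷ʳ c)))
  ≡⟨ sumRange-cong (suc n) (λ c → sumRange-cong (suc (n ∸ c)) (λ a →
       cong (λ e → sumCompositions k e (λ as → f (a ∷ as ∷ʳ c))) (m∸n∸o≡m∸o∸n n a c))) ⟩
    sumRange (suc n) (λ c → sumCompositions (suc k) (n ∸ c) (λ as → f (as ∷ʳ c)))
  ∎

sumList-boxes : (k N : ℕ) (f : List ℕ → ℚ) →
  sumList (boxes (suc k) N) f ≡ sumRange (suc N) (λ a → sumList (boxes k N) (f ∘ (a ∷_)))
sumList-boxes k N f =
  trans (sumList-concatMap (λ a → map (a ∷_) (boxes k N)) (upTo (suc N)) f)
        (trans (sumList-cong (upTo (suc N)) (λ a → sumList-map (a ∷_) (boxes k N) f))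
               (sumList-upTo (suc N) (λ a → sumList (boxes k N) (f ∘ (a ∷_)))))

+-≡ᵇ-∸ : ∀ {a s} t → a ≤ s → (a + t ≡ᵇ s) ≡ (t ≡ᵇ s ∸ a)
+-≡ᵇ-∸ t z≤n = refl
+-≡ᵇ-∸ t (s≤s a≤s) = +-≡ᵇ-∸ t a≤s

>⇒+-≡ᵇ-false : ∀ {a s} t → s < a → (a + t ≡ᵇ s) ≡ false
>⇒+-≡ᵇ-false {suc a} {zero} t _ = refl
>⇒+-≡ᵇ-false {suc a} {suc s} t (s≤s s<a) = >⇒+-≡ᵇ-false t s<a

sumList-boxes-sum≡ᵇ : (k s N : ℕ) → s ≤ N → (f : List ℕ → ℚ) →
  sumList (boxes k N) (λ as → if sum as ≡ᵇ s then f as else 0ℚ) ≡ sumCompositions k s f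
sumList-boxes-sum≡ᵇ zero zero N _ f = ℚP.+-identityʳ (f [])
sumList-boxes-sum≡ᵇ zero (suc s) N _ f = ℚP.+-identityˡ 0ℚ
sumList-boxes-sum≡ᵇ (suc k) s N s≤N f =
  trans (sumList-boxes k N _)
        (trans (sumRange-cong (suc N) first-part)
               (sym (sumRange-extend (suc s) (suc N) G (s≤s s≤N))))
  where
  G : ℕ → ℚ
  G a = sumCompositions k (s ∸ a) (f ∘ (a ∷_))
  first-part : ∀ a → sumList (boxes k N) (λ as → if a + sum as ≡ᵇ s then f (a ∷ as) else 0ℚ)
                   ≡ (if a <ᵇ suc s then G a else 0ℚ)
  first-part a with a ℕ.≤? s
  ... | yes a≤s rewrite ≤⇒<ᵇ-suc a≤s =
    trans (sumList-cong (boxes k N) (λ as →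
             cong (λ b → if b then f (a ∷ as) else 0ℚ) (+-≡ᵇ-∸ (sum as) a≤s)))
          (sumList-boxes-sum≡ᵇ k (s ∸ a) N (ℕP.≤-trans (ℕP.m∸n≤m s a) s≤N) (f ∘ (a ∷_)))
  ... | no a≰s rewrite >⇒<ᵇ-suc (ℕP.≰⇒> a≰s) =
    trans (sumList-cong (boxes k N) (λ as →
             cong (λ b → if b then f (a ∷ as) else 0ℚ) (>⇒+-≡ᵇ-false (sum as) (ℕP.≰⇒> a≰s))))
          (sumList-zero (boxes k N))

sumList-compositions : (k n : ℕ) (f : List ℕ → ℚ) →
  sumList (compositions k n) f ≡ sumCompositions k n f
sumList-compositions k n f =
  trans (sumList-filter (λ as → sum as ℕ.≟ n) (boxes k n) f) (sumList-boxes-sum≡ᵇ k n n ℕP.≤-refl f)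

x^ y^ : ℕ → Word
x^ n = replicate n x
y^ n = replicate n y

zs : List ℕ → Word
zs = concatMap (λ a → z (suc a))

replicate-∷ʳ : {A : Set} (c : A) (n : ℕ) → replicate n c ∷ʳ c ≡ c ∷ replicate n c
replicate-∷ʳ c zero = refl
replicate-∷ʳ c (suc n) = cong (c ∷_) (replicate-∷ʳ c n)

++-replicate-∷ʳ : {A : Set} (u : List A) (c : A) (n : ℕ) →
  (u ++ replicate n c) ∷ʳ c ≡ u ++ replicate (suc n) c
++-replicate-∷ʳ u c n = trans (LP.++-assoc u (replicate n c) (c ∷ [])) (cong (u ++_) (replicate-∷ʳ c n))

replicate-++-∷ : {A : Set} (c : A) (n : ℕ) (v : List A) →
  replicate n c ++ c ∷ v ≡ c ∷ replicate n c ++ v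
replicate-++-∷ c zero v = refl
replicate-++-∷ c (suc n) v = cong (c ∷_) (replicate-++-∷ c n v)

replicate-++ : {A : Set} (c : A) (a b : ℕ) → replicate a c ++ replicate b c ≡ replicate (a + b) c
replicate-++ c zero b = refl
replicate-++ c (suc a) b = cong (c ∷_) (replicate-++ c a b)

z1^≡y^ : ∀ r → z1^ r ≡ y^ r
z1^≡y^ r = go (λ i → i) r
  where
  go : (h : ℕ → ℕ) (r : ℕ) → concatMap (λ _ → z 1) (applyUpTo h r) ≡ y^ r
  go h zero = refl
  go h (suc r) = cong (y ∷_) (go (h ∘ suc) r)

z-+1 : ∀ n → z (n + 1) ≡ x^ n ++ y ∷ []
z-+1 n = cong z (ℕP.+-comm n 1)

z-+2 : ∀ n → z (n + 2) ≡ x^ (suc n) ++ y ∷ []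
z-+2 n = cong z (ℕP.+-comm n 2)

x^-++-zs-∷ : ∀ i b as → x^ i ++ zs (b ∷ as) ≡ x^ (i + b) ++ y ∷ zs as
x^-++-zs-∷ i b as = begin
    x^ i ++ (x^ b ++ y ∷ []) ++ zs as
  ≡⟨ cong (x^ i ++_) (LP.++-assoc (x^ b) (y ∷ []) (zs as)) ⟩
    x^ i ++ x^ b ++ y ∷ zs as
  ≡⟨ sym (LP.++-assoc (x^ i) (x^ b) (y ∷ zs as)) ⟩
    (x^ i ++ x^ b) ++ y ∷ zs as
  ≡⟨ cong (_++ y ∷ zs as) (replicate-++ x i b) ⟩
    x^ (i + b) ++ y ∷ zs as
  ∎

compTerm-∷ʳ : (as : List ℕ) (c : ℕ) (g : Word → ℚ) →
  ⟨ compTerm (as ∷ʳ c) ∣ g ⟩ ≡ ℕ→ℚ (suc c) * g (x^ (suc c) ++ y ∷ zs as)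
compTerm-∷ʳ as c g rewrite LP.reverse-++ as (c ∷ []) =
  trans (⟨·⟩ (ℕ→ℚ (suc c)) (word (z (c + 2) ++ zs (reverse (reverse as)))) g)
        (cong (λ u → ℕ→ℚ (suc c) * u) (trans (⟨word⟩ _ g) (cong g word-eq)))
  where
  word-eq : z (c + 2) ++ zs (reverse (reverse as)) ≡ x^ (suc c) ++ y ∷ zs as
  word-eq = trans (cong₂ _++_ (z-+2 c) (cong zs (LP.reverse-involutive as)))
                  (LP.++-assoc (x^ (suc c)) (y ∷ []) (zs as))

shuffleSum-∷-x^ : (c : Letter) (v : Word) (n : ℕ) (g : Word → ℚ) →
  shuffleSum (c ∷ v) (x^ n) g
  ≡ sumRange (suc n) (λ i → shuffleSum v (x^ (n ∸ i)) (λ u → g (x^ i ++ c ∷ u)))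
shuffleSum-∷-x^ c v zero g = sym (trans (ℚP.+-identityʳ _) (shuffleSum-[]ʳ v (g ∘ (c ∷_))))
shuffleSum-∷-x^ c v (suc n) g =
  cong (shuffleSum v (x^ (suc n)) (g ∘ (c ∷_)) ℚ.+_) (shuffleSum-∷-x^ c v n (g ∘ (x ∷_)))

shuffleSum-y^-x^ : (m j : ℕ) (g : Word → ℚ) →
  shuffleSum (y^ m) (x^ j) (g ∘ (_∷ʳ y)) ≡ sumCompositions (suc m) j (g ∘ zs)
shuffleSum-y^-x^ zero j g =
  trans (cong g (sym (LP.++-identityʳ (x^ j ++ y ∷ []))))
        (sym (sumCompositions-singleton j (λ a as → g (zs (a ∷ as)))))
shuffleSum-y^-x^ (suc m) j g = begin
    shuffleSum (y ∷ y^ m) (x^ j) (g ∘ (_∷ʳ y))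
  ≡⟨ shuffleSum-∷-x^ y (y^ m) j (g ∘ (_∷ʳ y)) ⟩
    sumRange (suc j) (λ b → shuffleSum (y^ m) (x^ (j ∸ b)) (λ u → g ((x^ b ++ y ∷ u) ∷ʳ y)))
  ≡⟨ sumRange-cong (suc j) (λ b → begin
       shuffleSum (y^ m) (x^ (j ∸ b)) (λ u → g ((x^ b ++ y ∷ u) ∷ʳ y))
     ≡⟨ shuffleSum-cong (y^ m) (x^ (j ∸ b)) (λ u → cong g (LP.++-assoc (x^ b) (y ∷ u) (y ∷ []))) ⟩
       shuffleSum (y^ m) (x^ (j ∸ b)) (λ u → g (x^ b ++ y ∷ u ∷ʳ y))
     ≡⟨ shuffleSum-y^-x^ m (j ∸ b) (λ v → g (x^ b ++ y ∷ v)) ⟩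
       sumCompositions (suc m) (j ∸ b) (λ as → g (x^ b ++ y ∷ zs as))
     ≡⟨ sumCompositions-cong (suc m) (j ∸ b) (λ as →
          cong g (sym (LP.++-assoc (x^ b) (y ∷ []) (zs as)))) ⟩
       sumCompositions (suc m) (j ∸ b) (λ as → g (zs (b ∷ as)))
     ∎) ⟩
    sumRange (suc j) (λ b → sumCompositions (suc m) (j ∸ b) (λ as → g (zs (b ∷ as))))
  ∎

shuffleSum-x-x^ : (n : ℕ) (v : Word) (g : Word → ℚ) →
  shuffleSum (x ∷ []) (x^ n ++ v) g
  ≡ ℕ→ℚ n * g (x ∷ x^ n ++ v) ℚ.+ shuffleSum (x ∷ []) v (g ∘ (x^ n ++_))
shuffleSum-x-x^ zero v g =
  solve 2 (λ a s → s := con 0ℚ :* a :+ s) refl (g (x ∷ v)) (shuffleSum (x ∷ []) v g)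
shuffleSum-x-x^ (suc n) v g = begin
    g w ℚ.+ shuffleSum (x ∷ []) (x^ n ++ v) (g ∘ (x ∷_))
  ≡⟨ cong (g w ℚ.+_) (shuffleSum-x-x^ n v (g ∘ (x ∷_))) ⟩
    g w ℚ.+ (ℕ→ℚ n * g w ℚ.+ r)
  ≡⟨ solve 3 (λ a q r → a :+ (q :* a :+ r) := (con 1ℚ :+ q) :* a :+ r) refl (g w) (ℕ→ℚ n) r ⟩
    (1ℚ ℚ.+ ℕ→ℚ n) * g w ℚ.+ r
  ≡⟨ cong (λ q → q * g w ℚ.+ r) (sym (ℕ→ℚ-suc n)) ⟩
    ℕ→ℚ (suc n) * g w ℚ.+ r
  ∎
  where
  w : Word
  w = x ∷ x ∷ x^ n ++ v
  r : ℚ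
  r = shuffleSum (x ∷ []) v (λ t → g (x ∷ x^ n ++ t))

shuffleSum-x-y^ : (m : ℕ) (g : Word → ℚ) →
  shuffleSum (x ∷ []) (y^ m) g
  ≡ g (x ∷ y^ m) ℚ.+ sumRange m (λ j → g (y^ (suc j) ++ x ∷ y^ (m ∸ suc j)))
shuffleSum-x-y^ zero g = sym (ℚP.+-identityʳ (g (x ∷ [])))
shuffleSum-x-y^ (suc m) g = cong (g (x ∷ y^ (suc m)) ℚ.+_) (shuffleSum-x-y^ m (g ∘ (y ∷_)))

module Theorem2p7 (m n : ℕ) where

  summand : ℕ → Poly
  summand r = sgn r · (word (z 2 ++ z1^ (suc m ∸ r ∸ 2)) ⧢ word (z (n + 1) ++ z1^ r))

  w₀ : Word
  w₀ = z (n + 2) ++ z1^ m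

  w : ℕ → Word
  w j = z (n + 1) ++ z1^ j ++ z 2 ++ z1^ (suc m ∸ 2 ∸ j)

  boundary : Poly
  boundary = Σ (upTo m) (word ∘ w) ⊕ ℕ→ℚ (n + 1) · word w₀

  lhs rhs : Poly
  lhs = Σ (upTo m) summand
  rhs = Σ (compositions (suc m) n) compTerm ⊕ sgn (suc m) · boundary

  module _ (g : Word → ℚ) where

    h : Word → ℚ
    h = g ∘ (_∷ʳ y)

    H : ℕ → ℚ
    H r = shuffleSum (x ∷ y^ (m ∸ r)) (x^ n ++ y^ r) h

    ⟨summand⟩ : ∀ r → r < m → ⟨ summand r ∣ g ⟩ ≡ sgn r * (H (suc r) ℚ.+ H r)
    ⟨summand⟩ r r<m = begin
        ⟨ sgn r · (word u ⧢ word v) ∣ g ⟩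
      ≡⟨ trans (⟨·⟩ (sgn r) (word u ⧢ word v) g) (cong (sgn r *_) (⟨⧢⟩ u v g)) ⟩
        sgn r * shuffleSum u v g
      ≡⟨ cong₂ (λ u v → sgn r * shuffleSum u v g) u≡ v≡ ⟩
        sgn r * shuffleSum ((x ∷ y^ d) ∷ʳ y) ((x^ n ++ y^ r) ∷ʳ y) g
      ≡⟨ cong (sgn r *_) (shuffleSum-∷ʳ (x ∷ y^ d) (x^ n ++ y^ r) y y g) ⟩
        sgn r * (shuffleSum (x ∷ y^ d) ((x^ n ++ y^ r) ∷ʳ y) h
                 ℚ.+ shuffleSum ((x ∷ y^ d) ∷ʳ y) (x^ n ++ y^ r) h)
      ≡⟨ cong₂ (λ u v → sgn r * (shuffleSum (x ∷ y^ d) v h ℚ.+ shuffleSum u (x^ n ++ y^ r) h))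
               (++-replicate-∷ʳ (x ∷ []) y d) (++-replicate-∷ʳ (x^ n) y r) ⟩
        sgn r * (H (suc r) ℚ.+ shuffleSum (x ∷ y^ (suc d)) (x^ n ++ y^ r) h)
      ≡⟨ cong (λ e → sgn r * (H (suc r) ℚ.+ shuffleSum (x ∷ y^ e) (x^ n ++ y^ r) h))
              (sym (ℕP.+-∸-assoc 1 r<m)) ⟩
        sgn r * (H (suc r) ℚ.+ H r)
      ∎
      where
      d : ℕ
      d = m ∸ suc r
      u v : Word
      u = z 2 ++ z1^ (suc m ∸ r ∸ 2)
      v = z (n + 1) ++ z1^ r
      u≡ : u ≡ (x ∷ y^ d) ∷ʳ y
      u≡ = trans (cong (λ t → x ∷ y ∷ t) (trans (z1^≡y^ _) (cong y^ index)))
                 (sym (++-replicate-∷ʳ (x ∷ []) y d))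
        where
        index : suc m ∸ r ∸ 2 ≡ d
        index = trans (ℕP.∸-+-assoc (suc m) r 2) (cong (suc m ∸_) (ℕP.+-comm r 2))
      v≡ : v ≡ (x^ n ++ y^ r) ∷ʳ y
      v≡ = trans (cong₂ _++_ (z-+1 n) (z1^≡y^ r))
                 (trans (LP.++-assoc (x^ n) (y ∷ []) (y^ r)) (sym (++-replicate-∷ʳ (x^ n) y r)))

    ⟨Σsummand⟩ : ⟨ Σ (upTo m) summand ∣ g ⟩ ≡ H 0 ℚ.+ sgn (suc m) * H m
    ⟨Σsummand⟩ =
      trans (⟨Σ⟩ (upTo m) summand g)
            (trans (sumList-upTo m (λ r → ⟨ summand r ∣ g ⟩))
                   (trans (sumRange-cong< m ⟨summand⟩) (sumRange-alternating-telescope m H)))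

    F : ℕ → ℕ → ℚ
    F c e = sumCompositions m e (λ as → g (x^ (suc c) ++ y ∷ zs as))

    H₀≡ : H 0 ≡ sumRange (suc n) (λ c → ℕ→ℚ (suc c) * F c (n ∸ c))
    H₀≡ = begin
        shuffleSum (x ∷ y^ m) (x^ n ++ []) h
      ≡⟨ cong (λ v → shuffleSum (x ∷ y^ m) v h) (LP.++-identityʳ (x^ n)) ⟩
        shuffleSum (x ∷ y^ m) (x^ n) h
      ≡⟨ shuffleSum-∷-x^ x (y^ m) n h ⟩
        sumRange (suc n) (λ i → shuffleSum (y^ m) (x^ (n ∸ i)) (λ u → h (x^ i ++ x ∷ u)))
      ≡⟨ sumRange-cong (suc n) (λ i →
           trans (shuffleSum-cong (y^ m) (x^ (n ∸ i)) (λ u → cong g (shift i u)))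
                 (shuffleSum-y^-x^ m (n ∸ i) (λ v → g (x^ (suc i) ++ v)))) ⟩
        sumRange (suc n) (λ i → sumCompositions (suc m) (n ∸ i) (λ as → g (x^ (suc i) ++ zs as)))
      ≡⟨ sumRange-cong (suc n) (λ i → sumRange-cong (suc (n ∸ i)) (λ b →
           sumCompositions-cong m (n ∸ i ∸ b) (λ as → cong (g ∘ (x ∷_)) (x^-++-zs-∷ i b as)))) ⟩
        sumTriangle n (λ i b → F (i + b) (n ∸ i ∸ b))
      ≡⟨ sumTriangle-antidiagonal n F ⟩
        sumRange (suc n) (λ c → ℕ→ℚ (suc c) * F c (n ∸ c))
      ∎
      where
      shift : ∀ i u → (x^ i ++ x ∷ u) ∷ʳ y ≡ x^ (suc i) ++ u ∷ʳ y
      shift i u = trans (LP.++-assoc (x^ i) (x ∷ u) (y ∷ [])) (replicate-++-∷ x i (u ∷ʳ y))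

    ⟨compositions⟩≡ :
      ⟨ Σ (compositions (suc m) n) compTerm ∣ g ⟩ ≡ sumRange (suc n) (λ c → ℕ→ℚ (suc c) * F c (n ∸ c))
    ⟨compositions⟩≡ = begin
        ⟨ Σ (compositions (suc m) n) compTerm ∣ g ⟩
      ≡⟨ ⟨Σ⟩ (compositions (suc m) n) compTerm g ⟩
        sumList (compositions (suc m) n) (λ as → ⟨ compTerm as ∣ g ⟩)
      ≡⟨ sumList-compositions (suc m) n (λ as → ⟨ compTerm as ∣ g ⟩) ⟩
        sumCompositions (suc m) n (λ as → ⟨ compTerm as ∣ g ⟩)
      ≡⟨ sumCompositions-∷ʳ m n (λ as → ⟨ compTerm as ∣ g ⟩) ⟩
        sumRange (suc n) (λ c → sumCompositions m (n ∸ c) (λ as → ⟨ compTerm (as ∷ʳ c) ∣ g ⟩))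
      ≡⟨ sumRange-cong (suc n) (λ c →
           trans (sumCompositions-cong m (n ∸ c) (λ as → compTerm-∷ʳ as c g))
                 (sumCompositions-*ˡ m (n ∸ c) (ℕ→ℚ (suc c)) (λ as → g (x^ (suc c) ++ y ∷ zs as)))) ⟩
        sumRange (suc n) (λ c → ℕ→ℚ (suc c) * F c (n ∸ c))
      ∎

    Hₘ≡ : H m ≡ sumRange m (g ∘ w) ℚ.+ ℕ→ℚ (n + 1) * g w₀
    Hₘ≡ = begin
        shuffleSum (x ∷ y^ (m ∸ m)) (x^ n ++ y^ m) h
      ≡⟨ cong (λ e → shuffleSum (x ∷ y^ e) (x^ n ++ y^ m) h) (ℕP.n∸n≡0 m) ⟩
        shuffleSum (x ∷ []) (x^ n ++ y^ m) h
      ≡⟨ shuffleSum-x-x^ n (y^ m) h ⟩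
        ℕ→ℚ n * h (x ∷ x^ n ++ y^ m) ℚ.+ shuffleSum (x ∷ []) (y^ m) (h ∘ (x^ n ++_))
      ≡⟨ cong (ℕ→ℚ n * h (x ∷ x^ n ++ y^ m) ℚ.+_) (shuffleSum-x-y^ m (h ∘ (x^ n ++_))) ⟩
        ℕ→ℚ n * h (x ∷ x^ n ++ y^ m) ℚ.+ (h (x^ n ++ x ∷ y^ m) ℚ.+ sumRange m (h ∘ insert))
      ≡⟨ cong₂ (λ a b → ℕ→ℚ n * g a ℚ.+ (g b ℚ.+ sumRange m (h ∘ insert)))
               (trans (++-replicate-∷ʳ (x ∷ x^ n) y m) (sym w₀≡)) (trans x-at-end (sym w₀≡)) ⟩
        ℕ→ℚ n * g w₀ ℚ.+ (g w₀ ℚ.+ sumRange m (h ∘ insert))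
      ≡⟨ cong (λ s → ℕ→ℚ n * g w₀ ℚ.+ (g w₀ ℚ.+ s)) (sumRange-cong m (cong g ∘ insert≡w)) ⟩
        ℕ→ℚ n * g w₀ ℚ.+ (g w₀ ℚ.+ sumRange m (g ∘ w))
      ≡⟨ solve 3 (λ q a s → q :* a :+ (a :+ s) := s :+ (con 1ℚ :+ q) :* a)
                 refl (ℕ→ℚ n) (g w₀) (sumRange m (g ∘ w)) ⟩
        sumRange m (g ∘ w) ℚ.+ (1ℚ ℚ.+ ℕ→ℚ n) * g w₀
      ≡⟨ cong (λ q → sumRange m (g ∘ w) ℚ.+ q * g w₀) (sym (ℕ→ℚ-+1 n)) ⟩
        sumRange m (g ∘ w) ℚ.+ ℕ→ℚ (n + 1) * g w₀
      ∎
      where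
      insert : ℕ → Word
      insert j = x^ n ++ y^ (suc j) ++ x ∷ y^ (m ∸ suc j)
      w₀≡ : w₀ ≡ x ∷ x^ n ++ y^ (suc m)
      w₀≡ = trans (cong₂ _++_ (z-+2 n) (z1^≡y^ m)) (LP.++-assoc (x^ (suc n)) (y ∷ []) (y^ m))
      x-at-end : (x^ n ++ x ∷ y^ m) ∷ʳ y ≡ x ∷ x^ n ++ y^ (suc m)
      x-at-end = trans (LP.++-assoc (x^ n) (x ∷ y^ m) (y ∷ []))
                       (trans (cong (λ t → x^ n ++ x ∷ t) (replicate-∷ʳ y m))
                              (replicate-++-∷ x n (y^ (suc m))))
      insert≡w : ∀ j → insert j ∷ʳ y ≡ w j
      insert≡w j = begin
          (x^ n ++ y^ (suc j) ++ x ∷ y^ (m ∸ suc j)) ∷ʳ y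
        ≡⟨ trans (LP.++-assoc (x^ n) _ (y ∷ []))
                 (cong (x^ n ++_) (LP.++-assoc (y^ (suc j)) _ (y ∷ []))) ⟩
          x^ n ++ y^ (suc j) ++ x ∷ y^ (m ∸ suc j) ∷ʳ y
        ≡⟨ cong (λ t → x^ n ++ y^ (suc j) ++ x ∷ t)
                (trans (replicate-∷ʳ y (m ∸ suc j)) (cong (y^ ∘ suc) (sym (ℕP.∸-+-assoc m 1 j)))) ⟩
          x^ n ++ y^ (suc j) ++ x ∷ y^ (suc (suc m ∸ 2 ∸ j))
        ≡⟨ sym (trans (cong₂ _++_ (z-+1 n) (cong₂ (λ s t → s ++ x ∷ y ∷ t) (z1^≡y^ j) (z1^≡y^ _)))
                      (LP.++-assoc (x^ n) (y ∷ []) _)) ⟩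
          w j
        ∎

    ⟨boundary⟩ : ⟨ boundary ∣ g ⟩ ≡ sumRange m (g ∘ w) ℚ.+ ℕ→ℚ (n + 1) * g w₀
    ⟨boundary⟩ =
      trans (⟨⊕⟩ (Σ (upTo m) (word ∘ w)) (ℕ→ℚ (n + 1) · word w₀) g)
            (cong₂ ℚ._+_
                   (trans (⟨Σ⟩ (upTo m) (word ∘ w) g)
                          (trans (sumList-upTo m (λ j → ⟨ word (w j) ∣ g ⟩))
                                 (sumRange-cong m (λ j → ⟨word⟩ (w j) g))))
                   (trans (⟨·⟩ (ℕ→ℚ (n + 1)) (word w₀) g) (cong (ℕ→ℚ (n + 1) *_) (⟨word⟩ w₀ g))))

    pairing-identity : ⟨ lhs ∣ g ⟩ ≡ ⟨ rhs ∣ g ⟩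
    pairing-identity = begin
        ⟨ Σ (upTo m) summand ∣ g ⟩
      ≡⟨ ⟨Σsummand⟩ ⟩
        H 0 ℚ.+ sgn (suc m) * H m
      ≡⟨ cong₂ (λ a b → a ℚ.+ sgn (suc m) * b)
               (trans H₀≡ (sym ⟨compositions⟩≡)) (trans Hₘ≡ (sym ⟨boundary⟩)) ⟩
        ⟨ Σ (compositions (suc m) n) compTerm ∣ g ⟩ ℚ.+ sgn (suc m) * ⟨ boundary ∣ g ⟩
      ≡⟨ sym (trans (⟨⊕⟩ (Σ (compositions (suc m) n) compTerm) (sgn (suc m) · boundary) g)
                    (cong (⟨ Σ (compositions (suc m) n) compTerm ∣ g ⟩ ℚ.+_)
                          (⟨·⟩ (sgn (suc m)) boundary g))) ⟩
        ⟨ Σ (compositions (suc m) n) compTerm ⊕ sgn (suc m) · boundary ∣ g ⟩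
      ∎

theorem2p7 : (k n : ℕ) → 1 ≤ k → 1 ≤ n →
    Σ (upTo (k ∸ 1)) (λ r → sgn r · (word (z 2 ++ z1^ (k ∸ r ∸ 2)) ⧢ word (z (n + 1) ++ z1^ r)))
    ≈ Σ (compositions k n) compTerm
      ⊕ sgn k · (Σ (upTo (k ∸ 1)) (λ j → word (z (n + 1) ++ z1^ j ++ z 2 ++ z1^ (k ∸ 2 ∸ j)))
                 ⊕ ℕ→ℚ (n + 1) · word (z (n + 2) ++ z1^ (k ∸ 1)))
theorem2p7 (suc m) n _ _ = ≈-from-⟨⟩ {lhs} {rhs} pairing-identity
  where open Theorem2p7 m n
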